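{- Let $n>1$ and let $S$ be an ideal aperiodic orientable sequence of order $n$ of length $\ell$. Write $D^{ -1}(S)=\{T,\bar T\}$ where $T$ is the element beginning with $n$ zeros, and let $U=\bar{T}^R$ (the complement of $T$ written in reverse order). If $n$ is even, let $V$ be the sequence of length $2\ell-n+2$ consisting of the $\ell+1$ bits of $T$ followed by the last $\ell-n+1$ bits of $U$ (i.e. $U$ with its first $n$ bits removed). If $n$ is odd, let $V$ be the sequence of length $2\ell-n+3$ consisting of the $\ell+1$ bits of $T$ followed by the last $\ell-n+2$ bits of $U$ (i.e. $U$ with its first $n-1$ bits removed). Then in both cases $V$ is an ideal aperiodic orientable sequence of order $n+1$.
   Context: For a finite binary sequence $S=(s_0,\dots,s_{\ell-1})$, $\mathbf{s}_n(i)=(s_i,\dots,s_{i+n-1})$ for $0\le i\le\ell-n$; the reverse of a tuple or finite sequence $(u_0,\dots,u_{k-1})$ is $(u_{k-1},\dots,u_0)$, written with superscript $R$. $S$ is an aperiodic orientable sequence of order $n$ if the $2\ell-2n+2$ tuples $\mathbf{s}_n(i)$ and their reverses ($0\le i\le\ell-n$) are all distinct. It is ideal ($n>1$) if its first $n-1$ bits are all $0$ and its last $n-1$ bits are all $1$. The complement $\bar T$ swaps $0$ and $1$ in every position. Lempel map: $D(t_0,\dots,t_\ell)=(t_0\oplus t_1,\dots,t_{\ell-1}\oplus t_\ell)$ ($\oplus$ = addition mod 2); $D^{ -1}(S)$ is the set of binary sequences of length $\ell+1$ with $D(T)=S$ (it consists of a sequence and its complement). -}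

module Defs where

open import Data.Bool using (Bool; true; false; not; _xor_)
open import Data.Nat using (ℕ; zero; suc; _+_; _∸_; _≤_; _<ᵇ_)
open import Data.List using (List; []; _∷_; _++_; take; drop; length; replicate; reverse; map)
open import Data.List.Relation.Unary.Unique.Propositional using (Unique)
open import Relation.Binary.PropositionalEquality using (_≡_)
open import Data.Product using (_×_)

-- Binary sequences: lists of bits, 0 = false, 1 = true.
Seq : Set
Seq = List Bool

-- windows n S = [ s_n(0) , s_n(1) , ... , s_n(ℓ-n) ]  (empty if ℓ < n)
windows : ℕ → Seq → List Seq
windows n [] with n
... | zero = [] ∷ []
... | suc _ = []
windows n (x ∷ xs) with length (x ∷ xs) <ᵇ n
... | true = []
... | false = take n (x ∷ xs) ∷ windows n xs

AOS : ℕ → Seq → Set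
AOS n S = Unique (windows n S ++ map reverse (windows n S))

IsIdeal : ℕ → Seq → Set
IsIdeal n S =
  (n ∸ 1 ≤ length S) ×
  (take (n ∸ 1) S ≡ replicate (n ∸ 1) false) ×
  (drop (length S ∸ (n ∸ 1)) S ≡ replicate (n ∸ 1) true)

IdealAOS : ℕ → Seq → Set
IdealAOS n S = AOS n S × IsIdeal n S

comp : Seq → Seq
comp = map not

D : Seq → Seq
D [] = []
D (x ∷ []) = []
D (x ∷ y ∷ xs) = (x xor y) ∷ D (y ∷ xs)

-- Write S = A₀ ++ 1^(n-1). Integrating, T = P ++ a with a alternating of length n starting
-- with c, and D (P ++ [ c ]) = A₀. Deleting the last ⌊n/2⌋ bits of T leaves X such that
-- V = X ++ reverse (comp X): the reflected copy of X overlaps the alternating tail of T.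
-- Hence reverse V = comp V and D V = A₀ ++ 1^m ++ reverse A₀ with m = n - 1 (n even) or
-- m = n (n odd). The n-windows of D V are those of S, their reverses, and for odd n the
-- palindrome 1^n; they are distinct because S is orientable. So the (n+1)-windows of V have
-- distinct D-images, and as reverse V = comp V, a window that is also a reversed window has
-- the D-image of a complemented window, hence equals its own complement: impossible.
module Submission where

open import Defs
open import Data.Bool using (Bool; true; false; not; _xor_) renaming (T to True)
open import Data.Bool.Properties using (not-involutive; xor-comm; xor-inverseʳ; xor-annihilates-not)
open import Data.Empty using (⊥-elim)
open import Data.List using (List; []; _∷_; _++_; initLast; _∷ʳ′_; take; drop; length; replicate; reverse; map; [_])
open import Data.List.Properties
  using (++-assoc; ++-identityʳ; ++-cancelʳ; ++-conicalʳ; ∷-injectiveʳ; length-++; length-++-≤ˡ; length-++-≤ʳ;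
         length-reverse; length-map; length-take; length-drop; length-replicate; take-all; take-map; take++drop≡id;
         map-++; map-replicate; unfold-reverse; reverse-++; reverse-involutive; reverse-injective; reverse-map)
open import Data.List.Membership.Propositional using (_∈_; _∉_)
open import Data.List.Membership.Propositional.Properties using (∈-map⁺; ∈-map⁻; ∈-++⁺ʳ; ∈-++⁻)
open import Data.List.Relation.Binary.Permutation.Propositional using (_↭_; ↭⇒↭ₛ; ↭-sym; ↭-trans; prep)
open import Data.List.Relation.Binary.Permutation.Propositional.Properties using (++⁺ˡ; ↭-reverse; shift)
import Data.List.Relation.Binary.Permutation.Setoid.Properties as PermutationSetoid
import Data.List.Relation.Unary.All as All
open import Data.List.Relation.Unary.All.Properties using (¬Any⇒All¬)
open import Data.List.Relation.Unary.AllPairs using ([]; _∷_)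
open import Data.List.Relation.Unary.Any using (here; there)
import Data.List.Relation.Unary.Any.Properties as Any
open import Data.List.Relation.Unary.Unique.Propositional using (Unique)
import Data.List.Relation.Unary.Unique.Propositional.Properties as Unique
open import Data.Nat using (ℕ; zero; suc; _+_; _∸_; _≤_; _<_; _<ᵇ_; z≤n; s≤s; s≤s⁻¹; _≤?_)
open import Data.Nat.DivMod using (_%_; _/_; m≡m%n+[m/n]*n)
open import Data.Nat.Properties
  using (<ᵇ⇒<; <⇒<ᵇ; <⇒≱; ≰⇒>; ≤-refl; ≤-reflexive; ≤-trans; m⊓n≡m⇒m≤n; m≤n⇒m⊓n≡m;
         suc-injective; +-comm; +-suc; +-identityʳ; *-comm)
open import Data.Product using (_×_; _,_; ∃; ∃₂)
open import Data.Sum using (inj₁; inj₂)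
open import Function using (_∘′_)
open import Relation.Binary.PropositionalEquality hiding ([_])
open import Relation.Nullary using (¬_; yes; no; contradiction)

private variable
  A : Set

take-++-≤ : ∀ n (xs ys : List A) → n ≤ length xs → take n (xs ++ ys) ≡ take n xs
take-++-≤ zero    xs       ys n≤ = refl
take-++-≤ (suc n) (x ∷ xs) ys (s≤s n≤) = cong (x ∷_) (take-++-≤ n xs ys n≤)

drop-++-length : ∀ (xs ys : List A) → drop (length xs) (xs ++ ys) ≡ ys
drop-++-length []       ys = refl
drop-++-length (x ∷ xs) ys = drop-++-length xs ys

drop≡⇒take++ : ∀ m (xs ys : List A) → drop m xs ≡ ys → xs ≡ take m xs ++ ys
drop≡⇒take++ m xs ys drop≡ = trans (sym (take++drop≡id m xs)) (cong (take m xs ++_) drop≡)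

take≡replicate⇒≤length : ∀ n (xs : List A) {b} → take n xs ≡ replicate n b → n ≤ length xs
take≡replicate⇒≤length n xs take≡ =
  m⊓n≡m⇒m≤n (trans (sym (length-take n xs)) (trans (cong length take≡) (length-replicate n)))

drop-reverse : ∀ n (W : List A) → drop (length W ∸ n) (reverse W) ≡ reverse (take n W)
drop-reverse n W = begin
  drop (length W ∸ n) (reverse W)
    ≡⟨ cong₂ drop (trans (sym (length-drop n W)) (sym (length-reverse (drop n W))))
                  (trans (cong reverse (sym (take++drop≡id n W))) (reverse-++ (take n W) (drop n W))) ⟩
  drop (length (reverse (drop n W))) (reverse (drop n W) ++ reverse (take n W))
    ≡⟨ drop-++-length (reverse (drop n W)) (reverse (take n W)) ⟩
  reverse (take n W) ∎
  where open ≡-Reasoning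

replicate-++ : ∀ m n (b : A) → replicate m b ++ replicate n b ≡ replicate (m + n) b
replicate-++ zero    n b = refl
replicate-++ (suc m) n b = cong (b ∷_) (replicate-++ m n b)

replicate-∷-++ : ∀ k (b : A) Y → replicate k b ++ b ∷ Y ≡ b ∷ replicate k b ++ Y
replicate-∷-++ zero    b Y = refl
replicate-∷-++ (suc k) b Y = cong (b ∷_) (replicate-∷-++ k b Y)

reverse-replicate : ∀ k (b : A) → reverse (replicate k b) ≡ replicate k b
reverse-replicate zero    b = refl
reverse-replicate (suc k) b = begin
  reverse (b ∷ replicate k b)      ≡⟨ unfold-reverse b (replicate k b) ⟩
  reverse (replicate k b) ++ [ b ] ≡⟨ cong (_++ [ b ]) (reverse-replicate k b) ⟩
  replicate k b ++ [ b ]           ≡⟨ replicate-∷-++ k b [] ⟩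
  b ∷ replicate k b ++ []          ≡⟨ cong (b ∷_) (++-identityʳ (replicate k b)) ⟩
  b ∷ replicate k b                ∎
  where open ≡-Reasoning

mirror-replicate : ∀ i (b : A) X → (X ++ replicate i b) ++ b ∷ reverse (X ++ replicate i b)
                                   ≡ X ++ replicate (i + suc i) b ++ reverse X
mirror-replicate i b X = begin
  (X ++ bs) ++ b ∷ reverse (X ++ bs)              ≡⟨ cong (λ Z → (X ++ bs) ++ b ∷ Z) (reverse-++ X bs) ⟩
  (X ++ bs) ++ b ∷ reverse bs ++ reverse X        ≡⟨ cong (λ Z → (X ++ bs) ++ b ∷ Z ++ reverse X) (reverse-replicate i b) ⟩
  (X ++ bs) ++ replicate (suc i) b ++ reverse X   ≡⟨ ++-assoc X bs _ ⟩
  X ++ bs ++ replicate (suc i) b ++ reverse X     ≡⟨ cong (X ++_) (++-assoc bs (replicate (suc i) b) (reverse X)) ⟨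
  X ++ (bs ++ replicate (suc i) b) ++ reverse X   ≡⟨ cong (λ Z → X ++ Z ++ reverse X) (replicate-++ i (suc i) b) ⟩
  X ++ replicate (i + suc i) b ++ reverse X       ∎
  where
  open ≡-Reasoning
  bs = replicate i b

comp-involutive : ∀ xs → comp (comp xs) ≡ xs
comp-involutive []       = refl
comp-involutive (x ∷ xs) = cong₂ _∷_ (not-involutive x) (comp-involutive xs)

comp-fixed⇒[] : ∀ xs → xs ≡ comp xs → xs ≡ []
comp-fixed⇒[] []           _  = refl
comp-fixed⇒[] (true ∷ xs)  ()
comp-fixed⇒[] (false ∷ xs) ()

reverse-comp-++ : ∀ X Y → reverse (comp (X ++ Y)) ≡ reverse (comp Y) ++ reverse (comp X)
reverse-comp-++ X Y = trans (cong reverse (map-++ not X Y)) (reverse-++ (comp X) (comp Y))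

-- Windows

windows-short : ∀ n xs → length xs < n → windows n xs ≡ []
windows-short (suc n) []       _  = refl
windows-short n       (x ∷ xs) lt with suc (length xs) <ᵇ n in eq
... | true  = refl
... | false = ⊥-elim (subst True eq (<⇒<ᵇ lt))

windows-cons : ∀ n x xs → n ≤ suc (length xs) → windows n (x ∷ xs) ≡ take n (x ∷ xs) ∷ windows n xs
windows-cons n x xs n≤ with suc (length xs) <ᵇ n in eq
... | false = refl
... | true  = contradiction n≤ (<⇒≱ (<ᵇ⇒< (suc (length xs)) n (subst True (sym eq) _)))

windows-exact : ∀ k ys → length ys ≡ suc k → windows (suc k) ys ≡ [ ys ]
windows-exact k (y ∷ ys) refl = begin
  windows (suc k) (y ∷ ys)            ≡⟨ windows-cons (suc k) y ys ≤-refl ⟩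
  take (suc k) (y ∷ ys) ∷ windows (suc k) ys
    ≡⟨ cong₂ _∷_ (take-all (suc k) (y ∷ ys) ≤-refl) (windows-short (suc k) ys ≤-refl) ⟩
  [ y ∷ ys ]                          ∎
  where open ≡-Reasoning

-- Windows of order k+1 cannot straddle a block C of length k, so they split at C.
windows-++-overlap : ∀ k X C Y → length C ≡ k →
  windows (suc k) (X ++ C ++ Y) ≡ windows (suc k) (X ++ C) ++ windows (suc k) (C ++ Y)
windows-++-overlap k []      C Y refl = cong (_++ windows (suc k) (C ++ Y)) (sym (windows-short (suc k) C ≤-refl))
windows-++-overlap k (x ∷ X) C Y refl = begin
  windows (suc k) (x ∷ X ++ C ++ Y)
    ≡⟨ windows-cons (suc k) x (X ++ C ++ Y) (s≤s C≤XCY) ⟩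
  take (suc k) (x ∷ X ++ C ++ Y) ∷ windows (suc k) (X ++ C ++ Y)
    ≡⟨ cong₂ (λ w ws → (x ∷ w) ∷ ws) take-eq (windows-++-overlap k X C Y refl) ⟩
  take (suc k) (x ∷ X ++ C) ∷ windows (suc k) (X ++ C) ++ windows (suc k) (C ++ Y)
    ≡⟨ cong (_++ windows (suc k) (C ++ Y)) (windows-cons (suc k) x (X ++ C) (s≤s C≤XC)) ⟨
  windows (suc k) (x ∷ X ++ C) ++ windows (suc k) (C ++ Y) ∎
  where
  open ≡-Reasoning
  C≤XC : length C ≤ length (X ++ C)
  C≤XC = length-++-≤ʳ C {X}
  C≤XCY : length C ≤ length (X ++ C ++ Y)
  C≤XCY = subst (λ Z → length C ≤ length Z) (++-assoc X C Y) (≤-trans C≤XC (length-++-≤ˡ (X ++ C)))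
  take-eq : take (length C) (X ++ C ++ Y) ≡ take (length C) (X ++ C)
  take-eq = trans (cong (take (length C)) (sym (++-assoc X C Y))) (take-++-≤ (length C) (X ++ C) Y C≤XC)

windows-snoc : ∀ k X C x → length C ≡ k →
  windows (suc k) (X ++ C ++ [ x ]) ≡ windows (suc k) (X ++ C) ++ [ C ++ [ x ] ]
windows-snoc k X C x refl =
  trans (windows-++-overlap k X C [ x ] refl)
        (cong (windows (suc k) (X ++ C) ++_) (windows-exact k (C ++ [ x ]) (trans (length-++ C) (+-comm (length C) 1))))

windows-reverse : ∀ k xs → windows (suc k) (reverse xs) ≡ reverse (map reverse (windows (suc k) xs))
windows-reverse k xs with length xs ≤? k
... | yes xs≤k = trans (windows-short (suc k) (reverse xs) (s≤s (subst (_≤ k) (sym (length-reverse xs)) xs≤k)))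
                       (sym (cong (reverse ∘′ map reverse) (windows-short (suc k) xs (s≤s xs≤k))))
windows-reverse k [] | no xs≰k = contradiction z≤n xs≰k
windows-reverse k (x ∷ xs) | no xs≰k = begin
  windows (suc k) (reverse (x ∷ xs))
    ≡⟨ cong (windows (suc k)) reverse-split ⟩
  windows (suc k) (reverse R ++ reverse L ++ [ x ])
    ≡⟨ windows-snoc k (reverse R) (reverse L) x length-rL ⟩
  windows (suc k) (reverse R ++ reverse L) ++ [ reverse L ++ [ x ] ]
    ≡⟨ cong₂ (λ ws w → ws ++ [ w ]) (cong (windows (suc k)) (sym reverse-xs)) (sym (unfold-reverse x L)) ⟩
  windows (suc k) (reverse xs) ++ [ reverse (x ∷ L) ]
    ≡⟨ cong (_++ [ reverse (x ∷ L) ]) (windows-reverse k xs) ⟩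
  reverse (map reverse (windows (suc k) xs)) ++ [ reverse (x ∷ L) ]
    ≡⟨ unfold-reverse (reverse (x ∷ L)) (map reverse (windows (suc k) xs)) ⟨
  reverse (map reverse (take (suc k) (x ∷ xs) ∷ windows (suc k) xs))
    ≡⟨ cong (reverse ∘′ map reverse) (windows-cons (suc k) x xs (≰⇒> xs≰k)) ⟨
  reverse (map reverse (windows (suc k) (x ∷ xs))) ∎
  where
  open ≡-Reasoning
  L = take k xs
  R = drop k xs
  length-rL : length (reverse L) ≡ k
  length-rL = trans (length-reverse L) (trans (length-take k xs) (m≤n⇒m⊓n≡m (s≤s⁻¹ (≰⇒> xs≰k))))
  reverse-xs : reverse xs ≡ reverse R ++ reverse L
  reverse-xs = trans (cong reverse (sym (take++drop≡id k xs))) (reverse-++ L R)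
  reverse-split : reverse (x ∷ xs) ≡ reverse R ++ reverse L ++ [ x ]
  reverse-split = trans (unfold-reverse x xs) (trans (cong (_++ [ x ]) reverse-xs) (++-assoc (reverse R) (reverse L) [ x ]))

windows-palindrome-++-reverse : ∀ k X C → reverse C ≡ C →
  windows (suc k) (C ++ reverse X) ≡ reverse (map reverse (windows (suc k) (X ++ C)))
windows-palindrome-++-reverse k X C C-pal = begin
  windows (suc k) (C ++ reverse X)           ≡⟨ cong (λ Z → windows (suc k) (Z ++ reverse X)) C-pal ⟨
  windows (suc k) (reverse C ++ reverse X)   ≡⟨ cong (windows (suc k)) (reverse-++ X C) ⟨
  windows (suc k) (reverse (X ++ C))         ≡⟨ windows-reverse k (X ++ C) ⟩
  reverse (map reverse (windows (suc k) (X ++ C))) ∎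
  where open ≡-Reasoning

windows-map : ∀ (f : Bool → Bool) n xs → windows n (map f xs) ≡ map (map f) (windows n xs)
windows-map f zero    [] = refl
windows-map f (suc n) [] = refl
windows-map f n (x ∷ xs) with n ≤? length (x ∷ xs)
... | yes n≤ = begin
  windows n (map f (x ∷ xs))
    ≡⟨ windows-cons n (f x) (map f xs) (subst (n ≤_) (sym (length-map f (x ∷ xs))) n≤) ⟩
  take n (map f (x ∷ xs)) ∷ windows n (map f xs)
    ≡⟨ cong₂ _∷_ (take-map n (x ∷ xs)) (windows-map f n xs) ⟩
  map (map f) (take n (x ∷ xs) ∷ windows n xs)
    ≡⟨ cong (map (map f)) (windows-cons n x xs n≤) ⟨
  map (map f) (windows n (x ∷ xs)) ∎
  where open ≡-Reasoning
... | no n≰ = trans (windows-short n (map f (x ∷ xs)) (subst (_< n) (sym (length-map f (x ∷ xs))) (≰⇒> n≰)))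
                    (cong (map (map f)) (sym (windows-short n (x ∷ xs) (≰⇒> n≰))))

[]∉windows : ∀ n xs → [] ∉ windows (suc n) xs
[]∉windows n []       ()
[]∉windows n (x ∷ xs) []∈ with suc n ≤? length (x ∷ xs)
... | yes n< with subst ([] ∈_) (windows-cons (suc n) x xs n<) []∈
...   | there []∈′ = []∉windows n xs []∈′
[]∉windows n (x ∷ xs) []∈ | no n≮ with () ← subst ([] ∈_) (windows-short (suc n) (x ∷ xs) (≰⇒> n≮)) []∈

-- The Lempel map

D-take : ∀ n xs → D (take (suc n) xs) ≡ take n (D xs)
D-take zero    []           = refl
D-take zero    (x ∷ xs)     = refl
D-take (suc n) []           = refl
D-take (suc n) (x ∷ [])     = refl
D-take (suc n) (x ∷ y ∷ xs) = cong ((x xor y) ∷_) (D-take n (y ∷ xs))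

length-D : ∀ x xs → length (D (x ∷ xs)) ≡ length xs
length-D x []       = refl
length-D x (y ∷ xs) = cong suc (length-D y xs)

windows-D : ∀ n x xs → map D (windows (suc n) (x ∷ xs)) ≡ windows n (D (x ∷ xs))
windows-D zero    x [] = refl
windows-D (suc n) x [] = refl
windows-D n x (y ∷ ys) with n ≤? length (y ∷ ys)
... | yes n≤ = begin
  map D (windows (suc n) (x ∷ y ∷ ys))
    ≡⟨ cong (map D) (windows-cons (suc n) x (y ∷ ys) (s≤s n≤)) ⟩
  D (take (suc n) (x ∷ y ∷ ys)) ∷ map D (windows (suc n) (y ∷ ys))
    ≡⟨ cong₂ _∷_ (D-take n (x ∷ y ∷ ys)) (windows-D n y ys) ⟩
  take n (D (x ∷ y ∷ ys)) ∷ windows n (D (y ∷ ys))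
    ≡⟨ windows-cons n (x xor y) (D (y ∷ ys)) (subst (n ≤_) (sym (cong suc (length-D y ys))) n≤) ⟨
  windows n (D (x ∷ y ∷ ys)) ∎
  where open ≡-Reasoning
... | no n≰ =
  trans (cong (map D) (windows-short (suc n) (x ∷ y ∷ ys) (s≤s (≰⇒> n≰))))
        (sym (windows-short n (D (x ∷ y ∷ ys)) (subst (_< n) (sym (cong suc (length-D y ys))) (≰⇒> n≰))))

D-comp : ∀ xs → D (comp xs) ≡ D xs
D-comp []           = refl
D-comp (x ∷ [])     = refl
D-comp (x ∷ y ∷ xs) = cong₂ _∷_ (xor-annihilates-not x y) (D-comp (y ∷ xs))

D-++ : ∀ X c Y → D (X ++ c ∷ Y) ≡ D (X ++ [ c ]) ++ D (c ∷ Y)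
D-++ []           c Y = refl
D-++ (x ∷ [])     c Y = refl
D-++ (x ∷ y ∷ X)  c Y = cong ((x xor y) ∷_) (D-++ (y ∷ X) c Y)

D-reverse : ∀ xs → D (reverse xs) ≡ reverse (D xs)
D-reverse []           = refl
D-reverse (x ∷ [])     = refl
D-reverse (x ∷ y ∷ xs) = begin
  D (reverse (x ∷ y ∷ xs))
    ≡⟨ cong D reverse-unfold ⟩
  D (reverse xs ++ y ∷ [ x ])
    ≡⟨ D-++ (reverse xs) y [ x ] ⟩
  D (reverse xs ++ [ y ]) ++ [ y xor x ]
    ≡⟨ cong₂ (λ ys b → D ys ++ [ b ]) (sym (unfold-reverse y xs)) (xor-comm y x) ⟩
  D (reverse (y ∷ xs)) ++ [ x xor y ]
    ≡⟨ cong (_++ [ x xor y ]) (D-reverse (y ∷ xs)) ⟩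
  reverse (D (y ∷ xs)) ++ [ x xor y ]
    ≡⟨ unfold-reverse (x xor y) (D (y ∷ xs)) ⟨
  reverse (D (x ∷ y ∷ xs)) ∎
  where
  open ≡-Reasoning
  reverse-unfold : reverse (x ∷ y ∷ xs) ≡ reverse xs ++ y ∷ [ x ]
  reverse-unfold = trans (unfold-reverse x (y ∷ xs))
    (trans (cong (_++ [ x ]) (unfold-reverse y xs)) (++-assoc (reverse xs) [ y ] [ x ]))

-- Alternating blocks

alt : Bool → ℕ → Seq
alt b zero    = []
alt b (suc k) = b ∷ alt (not b) k

-- The bit that continues the alternating pattern after alt b k.
alt-next : Bool → ℕ → Bool
alt-next b zero    = b
alt-next b (suc k) = alt-next (not b) k

length-alt : ∀ b k → length (alt b k) ≡ k
length-alt b zero    = refl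
length-alt b (suc k) = cong suc (length-alt (not b) k)

alt-++ : ∀ b m n → alt b (m + n) ≡ alt b m ++ alt (alt-next b m) n
alt-++ b zero    n = refl
alt-++ b (suc m) n = cong (b ∷_) (alt-++ (not b) m n)

alt-snoc : ∀ b k → alt b (suc k) ≡ alt b k ++ [ alt-next b k ]
alt-snoc b zero    = refl
alt-snoc b (suc k) = cong (b ∷_) (alt-snoc (not b) k)

alt-next-not : ∀ b k → alt-next (not b) k ≡ not (alt-next b k)
alt-next-not b zero    = refl
alt-next-not b (suc k) = alt-next-not (not b) k

alt-next-involutive : ∀ b k → alt-next (alt-next b k) k ≡ b
alt-next-involutive b zero    = refl
alt-next-involutive b (suc k) = begin
  alt-next (not (alt-next (not b) k)) k ≡⟨ alt-next-not (alt-next (not b) k) k ⟩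
  not (alt-next (alt-next (not b) k) k) ≡⟨ cong not (alt-next-involutive (not b) k) ⟩
  not (not b)                           ≡⟨ not-involutive b ⟩
  b                                     ∎
  where open ≡-Reasoning

reverse-comp-alt : ∀ b k → reverse (comp (alt b k)) ≡ alt (alt-next b k) k
reverse-comp-alt b zero    = refl
reverse-comp-alt b (suc k) = begin
  reverse (not b ∷ comp (alt (not b) k))             ≡⟨ unfold-reverse (not b) (comp (alt (not b) k)) ⟩
  reverse (comp (alt (not b) k)) ++ [ not b ]        ≡⟨ cong (_++ [ not b ]) (reverse-comp-alt (not b) k) ⟩
  alt c k ++ [ not b ]                               ≡⟨ cong (λ b′ → alt c k ++ [ b′ ]) (alt-next-involutive (not b) k) ⟨
  alt c k ++ [ alt-next c k ]                        ≡⟨ alt-snoc c k ⟨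
  alt c (suc k)                                      ∎
  where
  open ≡-Reasoning
  c = alt-next (not b) k

D-alt : ∀ b k → D (alt b (suc k)) ≡ replicate k true
D-alt b zero    = refl
D-alt b (suc k) = cong₂ _∷_ (xor-inverseʳ b) (D-alt (not b) k)

D≡ones⇒alt : ∀ k x xs → D (x ∷ xs) ≡ replicate k true → x ∷ xs ≡ alt x (suc k)
D≡ones⇒alt zero    x     []           _ = refl
D≡ones⇒alt (suc k) true  (false ∷ xs) e = cong (true ∷_) (D≡ones⇒alt k false xs (∷-injectiveʳ e))
D≡ones⇒alt (suc k) false (true ∷ xs)  e = cong (false ∷_) (D≡ones⇒alt k true xs (∷-injectiveʳ e))
D≡ones⇒alt zero    x     (y ∷ xs)     ()
D≡ones⇒alt (suc k) x     []           ()
D≡ones⇒alt (suc k) true  (true ∷ xs)  ()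
D≡ones⇒alt (suc k) false (false ∷ xs) ()

D≡++ones⇒alt-suffix : ∀ A k x xs → D (x ∷ xs) ≡ A ++ replicate k true →
  ∃₂ λ P c → x ∷ xs ≡ P ++ alt c (suc k)
D≡++ones⇒alt-suffix []      k x xs       D≡ = [] , x , D≡ones⇒alt k x xs D≡
D≡++ones⇒alt-suffix (a ∷ A) k x []       ()
D≡++ones⇒alt-suffix (a ∷ A) k x (y ∷ ys) D≡ with D≡++ones⇒alt-suffix A k y ys (∷-injectiveʳ D≡)
... | P , c , ys≡ = x ∷ P , c , cong (x ∷_) ys≡

D-prefix-of-alt-suffix : ∀ P c k A → D (P ++ alt c (suc k)) ≡ A ++ replicate k true → D (P ++ [ c ]) ≡ A
D-prefix-of-alt-suffix P c k A D≡ = ++-cancelʳ (replicate k true) (D (P ++ [ c ])) A (begin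
  D (P ++ [ c ]) ++ replicate k true       ≡⟨ cong (D (P ++ [ c ]) ++_) (D-alt c k) ⟨
  D (P ++ [ c ]) ++ D (alt c (suc k))     ≡⟨ D-++ P c (alt (not c) k) ⟨
  D (P ++ alt c (suc k))                  ≡⟨ D≡ ⟩
  A ++ replicate k true                   ∎)
  where open ≡-Reasoning

-- Sequences X ++ reverse (comp X)

reverse≡comp-doubling : ∀ X → reverse (X ++ reverse (comp X)) ≡ comp (X ++ reverse (comp X))
reverse≡comp-doubling X = begin
  reverse (X ++ reverse (comp X))                 ≡⟨ reverse-++ X (reverse (comp X)) ⟩
  reverse (reverse (comp X)) ++ reverse X         ≡⟨ cong (_++ reverse X) (reverse-involutive (comp X)) ⟩
  comp X ++ reverse X                             ≡⟨ cong (λ Y → comp X ++ reverse Y) (comp-involutive X) ⟨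
  comp X ++ reverse (comp (comp X))               ≡⟨ cong (comp X ++_) (reverse-map not (comp X)) ⟨
  comp X ++ comp (reverse (comp X))               ≡⟨ map-++ not X (reverse (comp X)) ⟨
  comp (X ++ reverse (comp X))                    ∎
  where open ≡-Reasoning

D-doubling : ∀ X → X ≢ [] → D (X ++ reverse (comp X)) ≡ D X ++ true ∷ reverse (D X)
D-doubling X X≢[] with initLast X
... | []        = contradiction refl X≢[]
... | X′ ∷ʳ′ x  = begin
  D ((X′ ++ [ x ]) ++ reverse (comp (X′ ++ [ x ])))
    ≡⟨ cong (λ Y → D ((X′ ++ [ x ]) ++ Y)) (reverse-comp-++ X′ [ x ]) ⟩
  D ((X′ ++ [ x ]) ++ not x ∷ reverse (comp X′))
    ≡⟨ cong D (++-assoc X′ [ x ] _) ⟩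
  D (X′ ++ x ∷ not x ∷ reverse (comp X′))
    ≡⟨ D-++ X′ x _ ⟩
  D (X′ ++ [ x ]) ++ (x xor not x) ∷ D (not x ∷ reverse (comp X′))
    ≡⟨ cong₂ (λ b Y → D (X′ ++ [ x ]) ++ b ∷ D Y) (sym (xor-inverseʳ x)) (reverse-comp-++ X′ [ x ]) ⟨
  D (X′ ++ [ x ]) ++ true ∷ D (reverse (comp (X′ ++ [ x ])))
    ≡⟨ cong (λ Y → D (X′ ++ [ x ]) ++ true ∷ Y)
            (trans (D-reverse (comp (X′ ++ [ x ]))) (cong reverse (D-comp (X′ ++ [ x ])))) ⟩
  D (X′ ++ [ x ]) ++ true ∷ reverse (D (X′ ++ [ x ])) ∎
  where open ≡-Reasoning

doubling-overlap : ∀ X Y W → reverse (comp X) ≡ Y ++ W →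
  (X ++ Y) ++ drop (length Y + length Y) (reverse (comp (X ++ Y))) ≡ X ++ reverse (comp X)
doubling-overlap X Y W rcX≡ = begin
  (X ++ Y) ++ drop (length Y + length Y) (reverse (comp (X ++ Y)))
    ≡⟨ cong (λ Z → (X ++ Y) ++ drop (length Y + length Y) Z)
            (trans (reverse-comp-++ X Y) (cong (reverse (comp Y) ++_) rcX≡)) ⟩
  (X ++ Y) ++ drop (length Y + length Y) (reverse (comp Y) ++ Y ++ W)
    ≡⟨ cong ((X ++ Y) ++_) drop-eq ⟩
  (X ++ Y) ++ W
    ≡⟨ ++-assoc X Y W ⟩
  X ++ Y ++ W
    ≡⟨ cong (X ++_) rcX≡ ⟨
  X ++ reverse (comp X) ∎
  where
  open ≡-Reasoning
  length-rcY : length (reverse (comp Y)) ≡ length Y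
  length-rcY = trans (length-reverse (comp Y)) (length-map not Y)
  drop-eq : drop (length Y + length Y) (reverse (comp Y) ++ Y ++ W) ≡ W
  drop-eq = begin
    drop (length Y + length Y) (reverse (comp Y) ++ Y ++ W)
      ≡⟨ cong₂ (λ m Z → drop (m + length Y) Z) (sym length-rcY) (sym (++-assoc (reverse (comp Y)) Y W)) ⟩
    drop (length (reverse (comp Y)) + length Y) ((reverse (comp Y) ++ Y) ++ W)
      ≡⟨ cong (λ m → drop m ((reverse (comp Y) ++ Y) ++ W)) (length-++ (reverse (comp Y))) ⟨
    drop (length (reverse (comp Y) ++ Y)) ((reverse (comp Y) ++ Y) ++ W)
      ≡⟨ drop-++-length (reverse (comp Y) ++ Y) W ⟩
    W ∎

doubling-alt-suffix : ∀ P c h d {j} → j ≡ h + d →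
  (P ++ alt c (j + h)) ++ drop (h + h) (reverse (comp (P ++ alt c (j + h))))
    ≡ (P ++ alt c j) ++ reverse (comp (P ++ alt c j))
doubling-alt-suffix P c h d {j} refl = begin
  (P ++ alt c (j + h)) ++ drop (h + h) (reverse (comp (P ++ alt c (j + h))))
    ≡⟨ cong (λ Z → Z ++ drop (h + h) (reverse (comp Z))) Z≡XY ⟩
  (X ++ Y) ++ drop (h + h) (reverse (comp (X ++ Y)))
    ≡⟨ cong (λ m → (X ++ Y) ++ drop (m + m) (reverse (comp (X ++ Y)))) (length-alt c′ h) ⟨
  (X ++ Y) ++ drop (length Y + length Y) (reverse (comp (X ++ Y)))
    ≡⟨ doubling-overlap X Y W rcX≡ ⟩
  X ++ reverse (comp X) ∎
  where
  open ≡-Reasoning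
  c′ = alt-next c j
  X = P ++ alt c j
  Y = alt c′ h
  W = alt (alt-next c′ h) d ++ reverse (comp P)
  Z≡XY : P ++ alt c (j + h) ≡ X ++ Y
  Z≡XY = trans (cong (P ++_) (alt-++ c j h)) (sym (++-assoc P (alt c j) Y))
  rcX≡ : reverse (comp X) ≡ Y ++ W
  rcX≡ = begin
    reverse (comp (P ++ alt c j))                         ≡⟨ reverse-comp-++ P (alt c j) ⟩
    reverse (comp (alt c j)) ++ reverse (comp P)          ≡⟨ cong (_++ reverse (comp P)) (reverse-comp-alt c j) ⟩
    alt c′ (h + d) ++ reverse (comp P)                    ≡⟨ cong (_++ reverse (comp P)) (alt-++ c′ h d) ⟩
    (Y ++ alt (alt-next c′ h) d) ++ reverse (comp P)      ≡⟨ ++-assoc Y _ _ ⟩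
    Y ++ W                                                ∎

-- Orientability

Unique-resp-↭ : {xs ys : List Seq} → xs ↭ ys → Unique xs → Unique ys
Unique-resp-↭ xs↭ys = PermutationSetoid.Unique-resp-↭ (setoid Seq) (↭⇒↭ₛ xs↭ys)

Unique-++⇒disjoint : ∀ (xs ys : List A) {x} → Unique (xs ++ ys) → x ∈ xs → x ∉ ys
Unique-++⇒disjoint (x ∷ xs) ys (x∉ ∷ _) (here refl) x∈ys = All.lookup x∉ (∈-++⁺ʳ xs x∈ys) refl
Unique-++⇒disjoint (_ ∷ xs) ys (_ ∷ u)  (there x∈xs) x∈ys = Unique-++⇒disjoint xs ys u x∈xs x∈ys

Unique-map⇒injective : ∀ {B : Set} (f : A → B) {xs a b} → Unique (map f xs) →
  a ∈ xs → b ∈ xs → f a ≡ f b → a ≡ b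
Unique-map⇒injective f {x ∷ xs} _        (here refl) (here refl) _   = refl
Unique-map⇒injective f {x ∷ xs} (u ∷ _)  (here refl) (there b∈) fa≡ = contradiction fa≡ (All.lookup u (∈-map⁺ f b∈))
Unique-map⇒injective f {x ∷ xs} (u ∷ _)  (there a∈) (here refl) fa≡ = contradiction (sym fa≡) (All.lookup u (∈-map⁺ f a∈))
Unique-map⇒injective f {x ∷ xs} (_ ∷ us) (there a∈) (there b∈) fa≡ = Unique-map⇒injective f us a∈ b∈ fa≡

palindrome∉ˡ : ∀ {ws : List Seq} {w} → Unique (ws ++ map reverse ws) → reverse w ≡ w → w ∉ ws
palindrome∉ˡ {ws} u w-pal w∈ws =
  Unique-++⇒disjoint ws _ u w∈ws (subst (_∈ map reverse ws) w-pal (∈-map⁺ reverse w∈ws))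

palindrome∉ : ∀ {ws : List Seq} {w} → Unique (ws ++ map reverse ws) → reverse w ≡ w → w ∉ ws ++ map reverse ws
palindrome∉ {ws} u w-pal w∈ with ∈-++⁻ ws w∈
... | inj₁ w∈ws  = palindrome∉ˡ u w-pal w∈ws
... | inj₂ w∈rws with ∈-map⁻ reverse w∈rws
...   | v , v∈ws , refl = palindrome∉ˡ u w-pal (subst (_∈ ws) (trans (sym (reverse-involutive v)) w-pal) v∈ws)

module _ (k : ℕ) (X : Seq) (aos : AOS (suc k) (X ++ replicate k true)) where
  private
    ones : Seq
    ones = replicate k true
    ws : List Seq
    ws = windows (suc k) (X ++ ones)
    mirror : windows (suc k) (ones ++ reverse X) ≡ reverse (map reverse ws)
    mirror = windows-palindrome-++-reverse k X ones (reverse-replicate k true)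

  AOS⇒Unique-windows-mirror : Unique (windows (suc k) (X ++ ones ++ reverse X))
  AOS⇒Unique-windows-mirror = subst Unique (sym windows-eq)
      (Unique-resp-↭ (++⁺ˡ ws (↭-sym (↭-reverse (map reverse ws)))) aos)
    where
    windows-eq : windows (suc k) (X ++ ones ++ reverse X) ≡ ws ++ reverse (map reverse ws)
    windows-eq = trans (windows-++-overlap k X ones (reverse X) (length-replicate k)) (cong (ws ++_) mirror)

  -- One more 1 in the middle adds exactly one window, the palindrome 1^(k+1).
  AOS⇒Unique-windows-mirror-suc : Unique (windows (suc k) (X ++ true ∷ ones ++ reverse X))
  AOS⇒Unique-windows-mirror-suc = subst Unique (sym windows-eq)
      (Unique-resp-↭ (↭-trans (prep (true ∷ ones) (++⁺ˡ ws (↭-sym (↭-reverse (map reverse ws)))))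
                              (↭-sym (shift (true ∷ ones) ws _)))
        (¬Any⇒All¬ _ (palindrome∉ {ws} aos (reverse-replicate (suc k) true)) ∷ aos))
    where
    open ≡-Reasoning
    windows-eq : windows (suc k) (X ++ true ∷ ones ++ reverse X) ≡ ws ++ (true ∷ ones) ∷ reverse (map reverse ws)
    windows-eq = begin
      windows (suc k) (X ++ true ∷ ones ++ reverse X)
        ≡⟨ cong (λ Z → windows (suc k) (X ++ Z)) (replicate-∷-++ k true (reverse X)) ⟨
      windows (suc k) (X ++ ones ++ true ∷ reverse X)
        ≡⟨ windows-++-overlap k X ones (true ∷ reverse X) (length-replicate k) ⟩
      ws ++ windows (suc k) (ones ++ true ∷ reverse X)
        ≡⟨ cong (λ Z → ws ++ windows (suc k) Z) (replicate-∷-++ k true (reverse X)) ⟩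
      ws ++ windows (suc k) (true ∷ ones ++ reverse X)
        ≡⟨ cong (ws ++_) (windows-cons (suc k) true (ones ++ reverse X) (s≤s k≤)) ⟩
      ws ++ (true ∷ take k (ones ++ reverse X)) ∷ windows (suc k) (ones ++ reverse X)
        ≡⟨ cong₂ (λ w ws′ → ws ++ (true ∷ w) ∷ ws′) take-eq mirror ⟩
      ws ++ (true ∷ ones) ∷ reverse (map reverse ws) ∎
      where
      k≤ : k ≤ length (ones ++ reverse X)
      k≤ = subst (_≤ length (ones ++ reverse X)) (length-replicate k) (length-++-≤ˡ ones)
      take-eq : take k (ones ++ reverse X) ≡ ones
      take-eq = trans (take-++-≤ k ones (reverse X) (≤-reflexive (sym (length-replicate k))))
                      (take-all k ones (≤-reflexive (length-replicate k)))

reverse≡comp⇒AOS : ∀ n V → reverse V ≡ comp V → Unique (windows n (D V)) → AOS (suc n) V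
reverse≡comp⇒AOS n []       _        _  = []
reverse≡comp⇒AOS n (x ∷ xs) rev≡comp uD = Unique.++⁺ uws (Unique.map⁺ reverse-injective uws) disjoint
  where
  V = x ∷ xs
  ws = windows (suc n) V
  uDws : Unique (map D ws)
  uDws = subst Unique (sym (windows-D n x xs)) uD
  uws : Unique ws
  uws = Unique.map⁻ uDws
  -- A window w whose reverse is also a window: reverse V ≡ comp V makes it the complement
  -- of a window z with D z ≡ D w, so w ≡ z ≡ comp w, forcing w ≡ [].
  disjoint : ∀ {v} → ¬ (v ∈ ws × v ∈ map reverse ws)
  disjoint (v∈ , v∈r) with ∈-map⁻ reverse v∈r
  ... | w , w∈ , refl with ∈-map⁻ comp rw∈comp
    where
    rw∈comp : reverse w ∈ map comp ws
    rw∈comp = subst (reverse w ∈_)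
      (trans (sym (windows-reverse n V)) (trans (cong (windows (suc n)) rev≡comp) (windows-map not (suc n) V)))
      (Any.reverse⁺ (∈-map⁺ reverse w∈))
  ...   | z , z∈ , rw≡cz =
    []∉windows n V (subst (_∈ ws) (comp-fixed⇒[] (reverse w) (trans rw≡cz (cong comp (sym rw≡z)))) v∈)
    where
    rw≡z : reverse w ≡ z
    rw≡z = Unique-map⇒injective D uDws v∈ z∈ (trans (cong D rw≡cz) (D-comp z))

reverse≡comp⇒IsIdeal : ∀ n V → reverse V ≡ comp V → take n V ≡ replicate n false → IsIdeal (suc n) V
reverse≡comp⇒IsIdeal n V rev≡comp take≡ = n≤ , take≡ , drop≡
  where
  n≤ : n ≤ length V
  n≤ = take≡replicate⇒≤length n V take≡
  drop≡ : drop (length V ∸ n) V ≡ replicate n true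
  drop≡ = begin
    drop (length V ∸ n) V                          ≡⟨ cong₂ (λ m Z → drop (m ∸ n) Z) (sym (length-map not V)) V≡rcV ⟩
    drop (length (comp V) ∸ n) (reverse (comp V))  ≡⟨ drop-reverse n (comp V) ⟩
    reverse (take n (comp V))                      ≡⟨ cong reverse (trans (take-map n V) (cong comp take≡)) ⟩
    reverse (comp (replicate n false))             ≡⟨ cong reverse (map-replicate not n false) ⟩
    reverse (replicate n true)                     ≡⟨ reverse-replicate n true ⟩
    replicate n true                               ∎
    where
    open ≡-Reasoning
    V≡rcV : V ≡ reverse (comp V)
    V≡rcV = trans (sym (reverse-involutive V)) (cong reverse rev≡comp)

doubling-IdealAOS : ∀ n P c i h d {A T m} → m ≡ h + h → T ≡ P ++ alt c (suc i + h) → suc i ≡ h + d →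
  D (P ++ [ c ]) ≡ A → Unique (windows n (A ++ replicate (i + suc i) true ++ reverse A)) →
  take n T ≡ replicate n false → IdealAOS (n + 1) (T ++ drop m (reverse (comp T)))
doubling-IdealAOS n P c i h d refl refl i+1≡ refl uniq take≡ = subst₂ IdealAOS (+-comm 1 n) (sym Z++≡V)
  ( reverse≡comp⇒AOS n V (reverse≡comp-doubling X) (subst (Unique ∘′ windows n) (sym DV≡) uniq)
  , reverse≡comp⇒IsIdeal n V (reverse≡comp-doubling X) (trans (cong (take n) (sym Z++≡V)) take-Z++≡))
  where
  Z = P ++ alt c (suc i + h)
  X = P ++ alt c (suc i)
  V = X ++ reverse (comp X)
  Z++≡V : Z ++ drop (h + h) (reverse (comp Z)) ≡ V
  Z++≡V = doubling-alt-suffix P c h d i+1≡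
  X≢[] : X ≢ []
  X≢[] X≡[] with () ← ++-conicalʳ P (alt c (suc i)) X≡[]
  DX≡ : D X ≡ D (P ++ [ c ]) ++ replicate i true
  DX≡ = trans (D-++ P c (alt (not c) i)) (cong (D (P ++ [ c ]) ++_) (D-alt c i))
  DV≡ : D V ≡ D (P ++ [ c ]) ++ replicate (i + suc i) true ++ reverse (D (P ++ [ c ]))
  DV≡ = trans (D-doubling X X≢[])
              (trans (cong (λ Y → Y ++ true ∷ reverse Y) DX≡) (mirror-replicate i true (D (P ++ [ c ]))))
  take-Z++≡ : take n (Z ++ drop (h + h) (reverse (comp Z))) ≡ replicate n false
  take-Z++≡ = trans (take-++-≤ n Z _ (take≡replicate⇒≤length n Z take≡)) take≡

half : ∀ n → n ≡ n % 2 + (n / 2 + n / 2)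
half n = trans (m≡m%n+[m/n]*n n 2) (cong (n % 2 +_) (trans (*-comm (n / 2) 2) (cong (n / 2 +_) (+-identityʳ (n / 2)))))

even⇒ : ∀ k → suc k % 2 ≡ 0 → ∃ λ i → k ≡ i + suc i
even⇒ k k+1-even = halve (suc k / 2) (trans (half (suc k)) (cong (_+ (suc k / 2 + suc k / 2)) k+1-even))
  where
  halve : ∀ h → suc k ≡ h + h → ∃ λ i → k ≡ i + suc i
  halve zero    ()
  halve (suc i) k+1≡ = i , suc-injective k+1≡

odd⇒ : ∀ k → suc k % 2 ≡ 1 → ∃ λ i → k ≡ i + i
odd⇒ k k+1-odd = suc k / 2 , suc-injective (trans (half (suc k)) (cong (_+ (suc k / 2 + suc k / 2)) k+1-odd))

theorem7 : (n : ℕ) → 1 < n → (S T : Seq) → IdealAOS n S →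
    D T ≡ S → take n T ≡ replicate n false →
    ((n % 2 ≡ 0 → IdealAOS (n + 1) (T ++ drop n (reverse (comp T)))) ×
     (n % 2 ≡ 1 → IdealAOS (n + 1) (T ++ drop (n ∸ 1) (reverse (comp T)))))
theorem7 zero    ()
-- The construction also works for n = 1; the hypothesis 1 < n only excludes n = 0.
theorem7 (suc k) _ S []       _                      _  ()
theorem7 (suc k) _ S (t ∷ T′) (aosS , _ , _ , drop≡) DT take≡
  with S≡ ← drop≡⇒take++ (length S ∸ k) S _ drop≡
  with P , c , T≡ ← D≡++ones⇒alt-suffix _ k t T′ (trans DT S≡) = even , odd
  where
  A₀ = take (length S ∸ k) S
  DPc≡ : D (P ++ [ c ]) ≡ A₀
  DPc≡ = D-prefix-of-alt-suffix P c k A₀ (trans (cong D (sym T≡)) (trans DT S≡))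
  aosA₀ : AOS (suc k) (A₀ ++ replicate k true)
  aosA₀ = subst (AOS (suc k)) S≡ aosS
  mirror : ℕ → Seq
  mirror m = A₀ ++ replicate m true ++ reverse A₀
  T≡′ : ∀ {j} → suc k ≡ j → t ∷ T′ ≡ P ++ alt c j
  T≡′ k+1≡ = trans T≡ (cong (λ j → P ++ alt c j) k+1≡)

  even : suc k % 2 ≡ 0 → IdealAOS (suc k + 1) ((t ∷ T′) ++ drop (suc k) (reverse (comp (t ∷ T′))))
  even k+1-even with i , k≡ ← even⇒ k k+1-even =
    doubling-IdealAOS (suc k) P c i (suc i) 0 (cong suc k≡) (T≡′ (cong suc k≡)) (sym (+-identityʳ (suc i))) DPc≡
      (subst (Unique ∘′ windows (suc k) ∘′ mirror) k≡ (AOS⇒Unique-windows-mirror k A₀ aosA₀)) take≡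

  odd : suc k % 2 ≡ 1 → IdealAOS (suc k + 1) ((t ∷ T′) ++ drop k (reverse (comp (t ∷ T′))))
  odd k+1-odd with i , k≡ ← odd⇒ k k+1-odd =
    doubling-IdealAOS (suc k) P c i i 1 k≡ (T≡′ (cong suc k≡)) (+-comm 1 i) DPc≡
      (subst (Unique ∘′ windows (suc k) ∘′ mirror) (trans (cong suc k≡) (sym (+-suc i i)))
             (AOS⇒Unique-windows-mirror-suc k A₀ aosA₀)) take≡
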